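{- Let $k\ge 3$ be an integer and let $\mathscr{C}_R(k)=\{\{1\},\{2\},\dots,\{k\},\{1,2\},\{2,3\},\dots,\{k-1,k\},\{1,k\}\}$, a code on $k$ neurons. Then the general relationship graph $G(\mathscr{C}_R(k))$ is a $2$-regular graph on $k$ vertices.
   Context: A neural code on $n$ neurons is a collection of subsets of $[n]$. A pseudo-monomial in $\mathbb{F}_2[x_1,\dots,x_n]$ is $\prod_{i\in\sigma}x_i\prod_{j\in\tau}(1-x_j)$ with $\sigma\cap\tau=\emptyset$. For an ideal $J$, a pseudo-monomial $f\in J$ is minimal if there is no pseudo-monomial $g\in J$ with $\deg g<\deg f$ and $g\mid f$; $\mathrm{CF}(J)$ is the set of minimal pseudo-monomials of $J$. With $\rho_v=\prod_{i\in v}x_i\prod_{j\notin v}(1-x_j)$, the neural ideal is $\mathcal{J}_\mathcal{C}=\langle\rho_v\mid v\subseteq[n],v\notin\mathcal{C}\rangle$. For $\sigma\subseteq[n]$ let $E_\sigma=\{x_i,1-x_i\mid i\in\sigma\}$. The general relationship complex is $GR(\mathcal{C})=\{\sigma\subseteq[n]\mid \prod_{\gamma\in\Gamma}\gamma\notin\mathrm{CF}(\mathcal{J}_\mathcal{C})\text{ for every }\Gamma\subseteq E_\sigma\}$, and the general relationship graph $G(\mathcal{C})$ is its $1$-skeleton: vertices are the $i\in[n]$ with $\{i\}\in GR(\mathcal{C})$ and edges are the pairs $\{i,j\}\in GR(\mathcal{C})$. A graph is $2$-regular if every vertex has degree exactly $2$. -}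

module Defs where

open import Data.Bool using (Bool; true; false; not; if_then_else_; _∨_)
open import Data.Nat as ℕ using (ℕ; zero; suc; _<_; _≡ᵇ_; _∸_; _⊔_)
open import Data.Fin using (Fin; toℕ)
open import Data.Fin.Subset as S using (Subset; _∈_; _⊆_; ⁅_⁆; _∪_; ∁)
open import Data.Vec as V using (Vec; replicate; tabulate; zipWith)
open import Data.Vec.Properties using (≡-dec)
open import Data.List as L using (List; []; _∷_; _++_; map; concatMap; foldr; allFin; upTo)
open import Data.List.Relation.Unary.All using (All)
import Data.List.Membership.Propositional as LM
open import Data.Product using (Σ; ∃; _×_; _,_)
open import Data.Empty using (⊥)
open import Relation.Nullary using (¬_)
open import Relation.Nullary.Decidable using (⌊_⌋)
open import Relation.Binary.PropositionalEquality using (_≡_)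

-- A monomial is its exponent vector; a polynomial is a finite list of
-- monomials, the coefficient (in F₂) of a monomial being the parity of
-- the number of times it occurs.

Monomial : ℕ → Set
Monomial n = Vec ℕ n

Poly : ℕ → Set
Poly n = List (Monomial n)

coeff : ∀ {n} → Monomial n → Poly n → Bool
coeff m [] = false
coeff m (q ∷ p) = if ⌊ ≡-dec ℕ._≟_ m q ⌋ then not (coeff m p) else coeff m p

infix 4 _≈_
_≈_ : ∀ {n} → Poly n → Poly n → Set
p ≈ q = ∀ m → coeff m p ≡ coeff m q

infixl 6 _+_ _-_
infixl 7 _*_

_+_ : ∀ {n} → Poly n → Poly n → Poly n
p + q = p ++ q

-- in characteristic 2, subtraction equals addition
_-_ : ∀ {n} → Poly n → Poly n → Poly n
p - q = p + q

_*_ : ∀ {n} → Poly n → Poly n → Poly n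
p * q = concatMap (λ a → map (zipWith ℕ._+_ a) q) p

one : ∀ {n} → Poly n
one {n} = replicate n 0 ∷ []

x : ∀ {n} → Fin n → Poly n
x i = tabulate (λ j → if toℕ i ≡ᵇ toℕ j then 1 else 0) ∷ []

sumP : ∀ {n} → List (Poly n) → Poly n
sumP = foldr _+_ []

prodOver : ∀ {n} → Subset n → (Fin n → Poly n) → Poly n
prodOver {n} s f = foldr (λ i acc → if V.lookup s i then f i * acc else acc) one (allFin n)

totalDeg : ∀ {n} → Monomial n → ℕ
totalDeg m = V.foldr _ ℕ._+_ 0 m

deg : ∀ {n} → Poly n → ℕ
deg p = foldr (λ m d → if coeff m p then totalDeg m ⊔ d else d) 0 p

_∣_ : ∀ {n} → Poly n → Poly n → Set
g ∣ f = ∃ λ h → f ≈ h * g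

Disjoint : ∀ {n} → Subset n → Subset n → Set
Disjoint σ τ = ∀ i → i ∈ σ → i ∈ τ → ⊥

pm : ∀ {n} → Subset n → Subset n → Poly n
pm σ τ = prodOver σ x * prodOver τ (λ j → one - x j)

IsPseudoMonomial : ∀ {n} → Poly n → Set
IsPseudoMonomial {n} f = Σ (Subset n) λ σ → Σ (Subset n) λ τ → Disjoint σ τ × (f ≈ pm σ τ)

Code : ℕ → Set
Code n = List (Subset n)

ρ : ∀ {n} → Subset n → Poly n
ρ v = prodOver v x * prodOver (∁ v) (λ j → one - x j)

InNeuralIdeal : ∀ {n} → Code n → Poly n → Set
InNeuralIdeal {n} C f =
  Σ (List (Subset n × Poly n)) λ gs →
    All (λ { (v , h) → ¬ (v LM.∈ C) }) gs ×
    (f ≈ sumP (map (λ { (v , h) → h * ρ v }) gs))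

InCF : ∀ {n} → Code n → Poly n → Set
InCF C f =
  IsPseudoMonomial f × InNeuralIdeal C f ×
  (∀ g → IsPseudoMonomial g → InNeuralIdeal C g → deg g < deg f → g ∣ f → ⊥)

-- σ ∈ GR(C): for every Γ ⊆ E_σ, ∏Γ ∉ CF(J_C).
-- Γ ⊆ E_σ is given by A ⊆ σ (the chosen x_i) and B ⊆ σ (the chosen 1 - x_j).
InGR : ∀ {n} → Code n → Subset n → Set
InGR C σ = ∀ A B → A ⊆ σ → B ⊆ σ → ¬ InCF C (prodOver A x * prodOver B (λ j → one - x j))

IsVertex : ∀ {n} → Code n → Fin n → Set
IsVertex C i = InGR C ⁅ i ⁆

IsEdge : ∀ {n} → Code n → Fin n → Fin n → Set
IsEdge C i j = ¬ (i ≡ j) × InGR C (⁅ i ⁆ ∪ ⁅ j ⁆)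

TwoRegularOnAll : ∀ {n} → Code n → Set
TwoRegularOnAll {n} C =
  (∀ i → IsVertex C i) ×
  (∀ i → Σ (Fin n) λ j₁ → Σ (Fin n) λ j₂ →
      ¬ (j₁ ≡ j₂) × IsEdge C i j₁ × IsEdge C i j₂ ×
      (∀ j → IsEdge C i j → (j ≡ j₁ Data.Sum.⊎ j ≡ j₂)))
  where import Data.Sum

-- The code C_R(k) (neurons 1..k are Fin k elements 0..k-1)

setOf : ∀ {k} → (ℕ → Bool) → Subset k
setOf P = tabulate (λ j → P (toℕ j))

CR : (k : ℕ) → Code k
CR k =
  map (λ a → setOf (λ j → j ≡ᵇ a)) (upTo k) ++
  map (λ a → setOf (λ j → (j ≡ᵇ a) ∨ (j ≡ᵇ suc a))) (upTo (k ∸ 1)) ++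
  (setOf (λ j → (j ≡ᵇ 0) ∨ (j ≡ᵇ (k ∸ 1))) ∷ [])

-- Evaluating polynomials at the points v ⊆ [n] of {0,1}ⁿ turns the question into
-- combinatorics of the code: ideal members vanish on every codeword, and conversely a
-- pseudo-monomial x_σ(1 - x)_τ lies in J_C as soon as no codeword contains σ and avoids
-- τ (split it along x_l + (1 - x_l) = 1 until it is a sum of ρ_v with v ∉ C).  Hence
-- σ ∈ GR(C) whenever every on/off pattern on σ occurs in some codeword, whereas x_i x_j
-- is a minimal pseudo-monomial of J_C when ⁅ i ⁆ and ⁅ j ⁆ are codewords but no codeword
-- contains both i and j.  In C_R(k) every singleton is a codeword and two distinct
-- neurons lie in a common codeword exactly when they are consecutive on the cycle
-- 0 — 1 — ⋯ — (k-1) — 0.  For consecutive i, j the patterns on {i, j} are realised by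
-- ⁅ i ⁆, ⁅ j ⁆, {i, j} and a third singleton (here k ≥ 3 is used), while for the other
-- pairs x_i x_j ∈ CF(J_C).
module Submission where

open import Defs
open import Algebra.Bundles using (CommutativeMonoid; CommutativeRing)
open import Data.Bool using (Bool; true; false; not; if_then_else_; _∨_; _∧_; _xor_; T)
open import Data.Bool.Properties
  using ( xor-same; xor-assoc; xor-comm; xor-identityʳ; not-involutive; not-distribʳ-xor; ¬-not
        ; ∧-comm; ∧-zeroʳ; ∧-identityʳ; ∧-distribˡ-xor; ∧-conicalˡ; ∧-conicalʳ; ∨-zeroʳ
        ; ∧-commutativeMonoid; xor-∧-commutativeRing; T-≡; T-∨)
open import Data.Empty using (⊥; ⊥-elim)
open import Data.Fin as F using (Fin; zero; suc; toℕ; fromℕ<)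
open import Data.Fin.Properties using (toℕ-injective; toℕ<n; toℕ-fromℕ<)
open import Data.Fin.Subset using (Subset; _∈_; _∉_; _⊆_; ∁; _∩_; _∪_; ⁅_⁆; Nonempty) renaming (⊥ to ∅)
open import Data.Fin.Subset.Properties
  using ( _∈?_; nonempty?; ⊆-refl; ⊆-antisym; ⊆-min; ⊆⊤; ∈⊤; ∉⊥; Empty-unique; x∈⁅x⁆; x∈⁅y⁆⇒x≡y
        ; x∉p⇒x∈∁p; x∈∁p⇒x∉p; x∈p∩q⁻; x∈p∩q⁺; x∈p∪q⁻; x∈p∪q⁺; p⊆p∪q; ∪-comm)
open import Data.List as L using (List; []; _∷_; _++_; map; foldr; length; allFin; upTo)
open import Data.List.Properties using (concat-++; map-++; ++-identityʳ)
open import Data.List.Membership.Propositional using () renaming (_∈_ to _∈ₗ_; _∉_ to _∉ₗ_)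
open import Data.List.Membership.Propositional.Properties
  using (∈-∃++; ∈-allFin; ∈-++⁺ˡ; ∈-++⁺ʳ; ∈-++⁻; ∈-map⁺; ∈-map⁻; ∈-upTo⁺)
open import Data.List.Relation.Unary.All as All using (All; []; _∷_)
import Data.List.Relation.Unary.All.Properties as All
open import Data.List.Relation.Unary.AllPairs using (_∷_)
open import Data.List.Relation.Unary.Any using (here; there)
open import Data.List.Relation.Unary.Any.Properties using (¬Any[])
open import Data.List.Relation.Unary.Unique.Propositional using (Unique)
open import Data.List.Relation.Unary.Unique.Propositional.Properties using (allFin⁺)
open import Data.Nat as ℕ using (ℕ; zero; suc; _≤_; _<_; _≡ᵇ_; _⊔_; z≤n; s≤s)
import Data.Nat.Properties as ℕ
open import Data.Nat.Induction using (<-wellFounded)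
open import Data.Product using (∃; _×_; _,_; proj₁; proj₂)
open import Data.Sum as Sum using (_⊎_; inj₁; inj₂; [_,_]; [_,_]′)
open import Data.Vec as V using ([]; _∷_; replicate; tabulate; zipWith)
open import Data.Vec.Properties
  using ( ≡-dec; lookup∘tabulate; zipWith-comm; zipWith-assoc; zipWith-identityˡ
        ; []=⇒lookup; lookup⇒[]=; lookup∘update; lookup∘update′; []≔-updates; []≔-minimal)
open import Function using (_∘_)
open import Function.Bundles using (Equivalence)
open import Induction.WellFounded using (Acc; acc)
open import Relation.Binary.Bundles using (Setoid)
open import Relation.Binary.PropositionalEquality
  using (_≡_; _≢_; refl; sym; trans; cong; cong₂; subst; module ≡-Reasoning)
import Relation.Binary.Reasoning.Setoid as SetoidReasoning
open import Relation.Nullary using (¬_; Dec; yes; no)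
open import Relation.Nullary.Decidable using (⌊_⌋; decidable-stable; _⊎-dec_; _×-dec_)
open import Algebra.Properties.CommutativeSemigroup
  (CommutativeMonoid.commutativeSemigroup ∧-commutativeMonoid)
  using () renaming (interchange to ∧-interchange)
open import Algebra.Properties.CommutativeSemigroup
  (CommutativeMonoid.commutativeSemigroup (CommutativeRing.+-commutativeMonoid xor-∧-commutativeRing))
  using () renaming (interchange to xor-interchange)

true≢false : true ≢ false
true≢false ()

xor-cancel-middle : ∀ a b c → a xor (b xor (a xor c)) ≡ b xor c
xor-cancel-middle false b c = refl
xor-cancel-middle true  b c = trans (not-distribʳ-xor b (not c)) (cong (b xor_) (not-involutive c))

xor≡false⇒≡ : ∀ {a b} → a xor b ≡ false → a ≡ b
xor≡false⇒≡ {false} a⊕b≡0 = sym a⊕b≡0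
xor≡false⇒≡ {true}  a⊕b≡0 = sym (trans (sym (not-involutive _)) (cong not a⊕b≡0))

∈-∷⁻ : ∀ {A : Set} {a b : A} {as} → a ∈ₗ b ∷ as → a ≢ b → a ∈ₗ as
∈-∷⁻ (here a≡b)   a≢b = ⊥-elim (a≢b a≡b)
∈-∷⁻ (there a∈as) _   = a∈as

-- Polynomial identities, tested against F₂-linear functionals

infixl 6 _⊞_
_⊞_ : ∀ {n} → Monomial n → Monomial n → Monomial n
_⊞_ = zipWith ℕ._+_

module _ {n : ℕ} where

  linExt : (Monomial n → Bool) → Poly n → Bool
  linExt f []      = false
  linExt f (m ∷ p) = f m xor linExt f p

  linExt-cong : ∀ {f g} (p : Poly n) → (∀ m → f m ≡ g m) → linExt f p ≡ linExt g p
  linExt-cong []      f≗g = refl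
  linExt-cong (m ∷ p) f≗g = cong₂ _xor_ (f≗g m) (linExt-cong p f≗g)

  linExt-++ : ∀ f (p q : Poly n) → linExt f (p ++ q) ≡ linExt f p xor linExt f q
  linExt-++ f []      q = refl
  linExt-++ f (m ∷ p) q = trans (cong (f m xor_) (linExt-++ f p q)) (sym (xor-assoc (f m) _ _))

  linExt-* : ∀ f (p q : Poly n) → linExt f (p * q) ≡ linExt (λ a → linExt (λ b → f (a ⊞ b)) q) p
  linExt-* f []      q = refl
  linExt-* f (a ∷ p) q =
    trans (linExt-++ f (map (a ⊞_) q) (p * q)) (cong₂ _xor_ (linExt-map q) (linExt-* f p q))
    where
    linExt-map : ∀ q → linExt f (map (a ⊞_) q) ≡ linExt (λ b → f (a ⊞ b)) q
    linExt-map []      = refl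
    linExt-map (b ∷ q) = cong (f (a ⊞ b) xor_) (linExt-map q)

  linExt-xor : ∀ f g (p : Poly n) → linExt (λ m → f m xor g m) p ≡ linExt f p xor linExt g p
  linExt-xor f g []      = refl
  linExt-xor f g (m ∷ p) =
    trans (cong ((f m xor g m) xor_) (linExt-xor f g p)) (xor-interchange (f m) (g m) _ _)

  linExt-zero : ∀ (p : Poly n) → linExt (λ _ → false) p ≡ false
  linExt-zero []      = refl
  linExt-zero (m ∷ p) = linExt-zero p

  linExt-swap : ∀ (F : Monomial n → Monomial n → Bool) (p q : Poly n) →
                linExt (λ a → linExt (F a) q) p ≡ linExt (λ b → linExt (λ a → F a b) p) q
  linExt-swap F []      q = sym (linExt-zero q)
  linExt-swap F (a ∷ p) q =
    trans (cong (linExt (F a) q xor_) (linExt-swap F p q)) (sym (linExt-xor (F a) _ q))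

  linExt-∧ˡ : ∀ c f (p : Poly n) → linExt (λ m → c ∧ f m) p ≡ c ∧ linExt f p
  linExt-∧ˡ c f []      = sym (∧-zeroʳ c)
  linExt-∧ˡ c f (m ∷ p) =
    trans (cong ((c ∧ f m) xor_) (linExt-∧ˡ c f p)) (sym (∧-distribˡ-xor c (f m) _))

  linExt-∧ʳ : ∀ c f (p : Poly n) → linExt (λ m → f m ∧ c) p ≡ linExt f p ∧ c
  linExt-∧ʳ c f p = trans (linExt-cong p (λ m → ∧-comm (f m) c)) (trans (linExt-∧ˡ c f p) (∧-comm c _))

  δ : Monomial n → Monomial n → Bool
  δ m m′ = ⌊ ≡-dec ℕ._≟_ m m′ ⌋

  coeff≡linExt-δ : ∀ m (p : Poly n) → coeff m p ≡ linExt (δ m) p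
  coeff≡linExt-δ m []      = refl
  coeff≡linExt-δ m (q ∷ p) with δ m q
  ... | true  = cong not (coeff≡linExt-δ m p)
  ... | false = coeff≡linExt-δ m p

  linExt-δ≡true⇒∈ : ∀ m (p : Poly n) → linExt (δ m) p ≡ true → m ∈ₗ p
  linExt-δ≡true⇒∈ m (q ∷ p) m∈p with ≡-dec ℕ._≟_ m q
  ... | yes m≡q = here m≡q
  ... | no  _   = there (linExt-δ≡true⇒∈ m p m∈p)

  linExt-δ-head : ∀ m (p : Poly n) → linExt (δ m) (m ∷ p) ≡ false → linExt (δ m) p ≡ true
  linExt-δ-head m p even with ≡-dec ℕ._≟_ m m
  ... | yes _   = trans (sym (not-involutive _)) (cong not even)
  ... | no m≢m = ⊥-elim (m≢m refl)

  linExt-cancel : ∀ f m (ys zs : Poly n) → linExt f (m ∷ ys ++ m ∷ zs) ≡ linExt f (ys ++ zs)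
  linExt-cancel f m ys zs = begin
    f m xor linExt f (ys ++ m ∷ zs)                    ≡⟨ cong (f m xor_) (linExt-++ f ys (m ∷ zs)) ⟩
    f m xor (linExt f ys xor (f m xor linExt f zs))    ≡⟨ xor-cancel-middle (f m) (linExt f ys) (linExt f zs) ⟩
    linExt f ys xor linExt f zs                        ≡⟨ linExt-++ f ys zs ⟨
    linExt f (ys ++ zs)                                ∎
    where open ≡-Reasoning

  -- Pairs of equal monomials cancel, so a list with all coefficients zero
  -- shrinks to the empty list without changing any linear functional.
  coeffs≡false⇒linExt≡false : ∀ f (p : Poly n) → (∀ m → coeff m p ≡ false) → linExt f p ≡ false
  coeffs≡false⇒linExt≡false f p even =
    go p (<-wellFounded (length p)) (λ m → trans (sym (coeff≡linExt-δ m p)) (even m))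
    where
    length-++-∷ : ∀ {m} (ys zs : Poly n) → length (ys ++ m ∷ zs) ≡ suc (length (ys ++ zs))
    length-++-∷ []       zs = refl
    length-++-∷ (y ∷ ys) zs = cong suc (length-++-∷ ys zs)

    go : ∀ p → Acc _<_ (length p) → (∀ m → linExt (δ m) p ≡ false) → linExt f p ≡ false
    go []      _         _    = refl
    go (m ∷ p) (acc rec) even with ∈-∃++ (linExt-δ≡true⇒∈ m p (linExt-δ-head m p (even m)))
    ... | ys , zs , refl = trans (linExt-cancel f m ys zs)
      (go (ys ++ zs) (rec shorter) (λ m′ → trans (sym (linExt-cancel (δ m′) m ys zs)) (even m′)))
      where
      shorter : length (ys ++ zs) < suc (length (ys ++ m ∷ zs))
      shorter rewrite length-++-∷ {m} ys zs = ℕ.m<n⇒m<1+n (ℕ.n<1+n _)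

  -- Equality of polynomials tested against every F₂-linear functional; it
  -- coincides with _≈_ (≈⇒≋, ≋⇒≈) but its congruence laws are immediate.
  infix 4 _≋_
  record _≋_ (p q : Poly n) : Set where
    constructor mk≋
    field linExt-≡ : ∀ f → linExt f p ≡ linExt f q
  open _≋_ public

  ≈⇒≋ : ∀ {p q : Poly n} → p ≈ q → p ≋ q
  ≈⇒≋ {p} {q} p≈q = mk≋ λ f →
    xor≡false⇒≡ (trans (sym (linExt-++ f p q)) (coeffs≡false⇒linExt≡false f (p ++ q) coeff-++≡false))
    where
    coeff-++≡false : ∀ m → coeff m (p ++ q) ≡ false
    coeff-++≡false m = begin
      coeff m (p ++ q)                     ≡⟨ coeff≡linExt-δ m (p ++ q) ⟩
      linExt (δ m) (p ++ q)                ≡⟨ linExt-++ (δ m) p q ⟩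
      linExt (δ m) p xor linExt (δ m) q    ≡⟨ cong₂ _xor_ (coeff≡linExt-δ m p) (coeff≡linExt-δ m q) ⟨
      coeff m p xor coeff m q              ≡⟨ cong (_xor coeff m q) (p≈q m) ⟩
      coeff m q xor coeff m q              ≡⟨ xor-same (coeff m q) ⟩
      false                                ∎
      where open ≡-Reasoning

  ≋⇒≈ : ∀ {p q : Poly n} → p ≋ q → p ≈ q
  ≋⇒≈ {p} {q} p≋q m =
    trans (coeff≡linExt-δ m p) (trans (linExt-≡ p≋q (δ m)) (sym (coeff≡linExt-δ m q)))

  ≋-setoid : Setoid _ _
  ≋-setoid = record
    { Carrier       = Poly n
    ; _≈_           = _≋_
    ; isEquivalence = record
      { refl  = mk≋ λ f → refl
      ; sym   = λ p≋q → mk≋ λ f → sym (linExt-≡ p≋q f)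
      ; trans = λ p≋q q≋r → mk≋ λ f → trans (linExt-≡ p≋q f) (linExt-≡ q≋r f)
      }
    }

  open Setoid ≋-setoid public
    using () renaming (refl to ≋-refl; reflexive to ≋-reflexive; sym to ≋-sym; trans to ≋-trans)

  ++-cong : ∀ {p p′ q q′ : Poly n} → p ≋ p′ → q ≋ q′ → p ++ q ≋ p′ ++ q′
  ++-cong {p} {p′} {q} {q′} p≋p′ q≋q′ = mk≋ λ f → trans (linExt-++ f p q)
    (trans (cong₂ _xor_ (linExt-≡ p≋p′ f) (linExt-≡ q≋q′ f)) (sym (linExt-++ f p′ q′)))

  ++-congˡ : ∀ p {q q′ : Poly n} → q ≋ q′ → p ++ q ≋ p ++ q′
  ++-congˡ p = ++-cong (≋-refl {p})

  ++-congʳ : ∀ q {p p′ : Poly n} → p ≋ p′ → p ++ q ≋ p′ ++ q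
  ++-congʳ q p≋p′ = ++-cong p≋p′ (≋-refl {q})

  *-cong : ∀ {p p′ q q′ : Poly n} → p ≋ p′ → q ≋ q′ → p * q ≋ p′ * q′
  *-cong {p} {p′} {q} {q′} p≋p′ q≋q′ = mk≋ λ f → begin
    linExt f (p * q)                                ≡⟨ linExt-* f p q ⟩
    linExt (λ a → linExt (λ b → f (a ⊞ b)) q) p     ≡⟨ linExt-cong p (λ a → linExt-≡ q≋q′ _) ⟩
    linExt (λ a → linExt (λ b → f (a ⊞ b)) q′) p    ≡⟨ linExt-≡ p≋p′ _ ⟩
    linExt (λ a → linExt (λ b → f (a ⊞ b)) q′) p′   ≡⟨ linExt-* f p′ q′ ⟨
    linExt f (p′ * q′)                              ∎
    where open ≡-Reasoning

  *-congˡ : ∀ p {q q′ : Poly n} → q ≋ q′ → p * q ≋ p * q′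
  *-congˡ p = *-cong (≋-refl {p})

  *-congʳ : ∀ q {p p′ : Poly n} → p ≋ p′ → p * q ≋ p′ * q
  *-congʳ q p≋p′ = *-cong p≋p′ (≋-refl {q})

  *-comm : ∀ (p q : Poly n) → p * q ≋ q * p
  *-comm p q = mk≋ λ f → begin
    linExt f (p * q)                               ≡⟨ linExt-* f p q ⟩
    linExt (λ a → linExt (λ b → f (a ⊞ b)) q) p    ≡⟨ linExt-swap (λ a b → f (a ⊞ b)) p q ⟩
    linExt (λ b → linExt (λ a → f (a ⊞ b)) p) q    ≡⟨ linExt-cong q (λ b → linExt-cong p (λ a →
                                                         cong f (zipWith-comm ℕ.+-comm a b))) ⟩
    linExt (λ b → linExt (λ a → f (b ⊞ a)) p) q    ≡⟨ linExt-* f q p ⟨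
    linExt f (q * p)                               ∎
    where open ≡-Reasoning

  *-assoc : ∀ (p q r : Poly n) → (p * q) * r ≋ p * (q * r)
  *-assoc p q r = mk≋ λ f → begin
    linExt f ((p * q) * r)
      ≡⟨ linExt-* f (p * q) r ⟩
    linExt (λ ab → linExt (λ c → f (ab ⊞ c)) r) (p * q)
      ≡⟨ linExt-* _ p q ⟩
    linExt (λ a → linExt (λ b → linExt (λ c → f (a ⊞ b ⊞ c)) r) q) p
      ≡⟨ linExt-cong p (λ a → linExt-cong q (λ b → linExt-cong r (λ c →
           cong f (zipWith-assoc ℕ.+-assoc a b c)))) ⟩
    linExt (λ a → linExt (λ b → linExt (λ c → f (a ⊞ (b ⊞ c))) r) q) p
      ≡⟨ linExt-cong p (λ a → linExt-* _ q r) ⟨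
    linExt (λ a → linExt (λ bc → f (a ⊞ bc)) (q * r)) p
      ≡⟨ linExt-* f p (q * r) ⟨
    linExt f (p * (q * r))
      ∎
    where open ≡-Reasoning

  *-identityˡ : ∀ (p : Poly n) → one * p ≋ p
  *-identityˡ p = mk≋ λ f → trans (linExt-* f one p)
    (trans (xor-identityʳ _) (linExt-cong p (λ b → cong f (zipWith-identityˡ ℕ.+-identityˡ b))))

  *-distribʳ-++ : ∀ (p q r : Poly n) → (p ++ q) * r ≋ p * r ++ q * r
  *-distribʳ-++ p q r = mk≋ λ f → begin
    linExt f ((p ++ q) * r)                  ≡⟨ linExt-* f (p ++ q) r ⟩
    linExt (g f) (p ++ q)                    ≡⟨ linExt-++ (g f) p q ⟩
    linExt (g f) p xor linExt (g f) q        ≡⟨ cong₂ _xor_ (linExt-* f p r) (linExt-* f q r) ⟨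
    linExt f (p * r) xor linExt f (q * r)    ≡⟨ linExt-++ f (p * r) (q * r) ⟨
    linExt f (p * r ++ q * r)                ∎
    where
    open ≡-Reasoning
    g : (Monomial n → Bool) → Monomial n → Bool
    g f a = linExt (λ b → f (a ⊞ b)) r

  ++-cancel : ∀ (p q : Poly n) → p ++ (q ++ p) ≋ q
  ++-cancel p q = mk≋ λ f → begin
    linExt f (p ++ (q ++ p))                     ≡⟨ linExt-++ f p (q ++ p) ⟩
    linExt f p xor linExt f (q ++ p)             ≡⟨ cong (linExt f p xor_) (linExt-++ f q p) ⟩
    linExt f p xor (linExt f q xor linExt f p)   ≡⟨ cong (linExt f p xor_) (xor-comm (linExt f q) _) ⟩
    linExt f p xor (linExt f p xor linExt f q)   ≡⟨ xor-assoc (linExt f p) _ _ ⟨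
    (linExt f p xor linExt f p) xor linExt f q   ≡⟨ cong (_xor linExt f q) (xor-same (linExt f p)) ⟩
    linExt f q                                   ∎
    where open ≡-Reasoning

  *-leftComm : ∀ (p q r : Poly n) → p * (q * r) ≋ q * (p * r)
  *-leftComm p q r = begin
    p * (q * r)    ≈⟨ *-assoc p q r ⟨
    (p * q) * r    ≈⟨ *-congʳ r (*-comm p q) ⟩
    (q * p) * r    ≈⟨ *-assoc q p r ⟩
    q * (p * r)    ∎
    where open SetoidReasoning ≋-setoid

  degOf : (Monomial n → Bool) → Poly n → ℕ
  degOf P = foldr (λ m d → if P m then totalDeg m ⊔ d else d) 0

  degOf-lub : ∀ P (L : Poly n) {b} → (∀ {m} → m ∈ₗ L → P m ≡ true → totalDeg m ≤ b) → degOf P L ≤ b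
  degOf-lub P []      bound = z≤n
  degOf-lub P (m ∷ L) bound with P m in Pm
  ... | true  = ℕ.⊔-lub (bound (here refl) Pm) (degOf-lub P L (bound ∘ there))
  ... | false = degOf-lub P L (bound ∘ there)

  ≤-degOf : ∀ P (L : Poly n) {m} → m ∈ₗ L → P m ≡ true → totalDeg m ≤ degOf P L
  ≤-degOf P (m′ ∷ L) m∈L Pm with P m′ in Pm′ | m∈L
  ... | true  | here refl  = ℕ.m≤m⊔n _ _
  ... | true  | there m∈L′ = ℕ.≤-trans (≤-degOf P L m∈L′ Pm) (ℕ.m≤n⊔m (totalDeg m′) _)
  ... | false | here refl  = ⊥-elim (true≢false (trans (sym Pm) Pm′))
  ... | false | there m∈L′ = ≤-degOf P L m∈L′ Pm

  deg-mono : ∀ (p q : Poly n) → p ≈ q → deg p ≤ deg q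
  deg-mono p q p≈q = degOf-lub (λ m → coeff m p) p λ {m} _ p-coeff≡true →
    let q-coeff≡true = trans (sym (p≈q m)) p-coeff≡true in
    ≤-degOf (λ m → coeff m q) q
      (linExt-δ≡true⇒∈ m q (trans (sym (coeff≡linExt-δ m q)) q-coeff≡true)) q-coeff≡true

-- Evaluation at the points of {0,1}ⁿ

monomialAt : ∀ {n} → Subset n → Monomial n → Bool
monomialAt []      []      = true
monomialAt (b ∷ d) (e ∷ m) = ((e ≡ᵇ 0) ∨ b) ∧ monomialAt d m

monomialAt-⊞ : ∀ {n} (d : Subset n) a b → monomialAt d (a ⊞ b) ≡ monomialAt d a ∧ monomialAt d b
monomialAt-⊞ []      []      []       = refl
monomialAt-⊞ (c ∷ d) (e ∷ a) (e′ ∷ b) = trans (cong₂ _∧_ (coordinate c e) (monomialAt-⊞ d a b))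
  (∧-interchange ((e ≡ᵇ 0) ∨ c) ((e′ ≡ᵇ 0) ∨ c) (monomialAt d a) (monomialAt d b))
  where
  coordinate : ∀ c e → ((e ℕ.+ e′ ≡ᵇ 0) ∨ c) ≡ ((e ≡ᵇ 0) ∨ c) ∧ ((e′ ≡ᵇ 0) ∨ c)
  coordinate c     zero    = refl
  coordinate false (suc e) = refl
  coordinate true  (suc e) = sym (∨-zeroʳ (e′ ≡ᵇ 0))

monomialAt-replicate0 : ∀ {n} (d : Subset n) → monomialAt d (replicate n 0) ≡ true
monomialAt-replicate0 []      = refl
monomialAt-replicate0 (b ∷ d) = monomialAt-replicate0 d

monomialAt-tabulate0 : ∀ {n} (d : Subset n) → monomialAt d (tabulate (λ _ → 0)) ≡ true
monomialAt-tabulate0 []      = refl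
monomialAt-tabulate0 (b ∷ d) = monomialAt-tabulate0 d

monomialAt-xᵢ : ∀ {n} (d : Subset n) (i : Fin n) →
                monomialAt d (tabulate (λ j → if toℕ i ≡ᵇ toℕ j then 1 else 0)) ≡ V.lookup d i
monomialAt-xᵢ (b ∷ d) zero    = trans (cong (b ∧_) (monomialAt-tabulate0 d)) (∧-identityʳ b)
monomialAt-xᵢ (b ∷ d) (suc i) = monomialAt-xᵢ d i

module _ {n : ℕ} {s : Subset n} {i : Fin n} where

  ∉⇒lookup≡false : i ∉ s → V.lookup s i ≡ false
  ∉⇒lookup≡false i∉s = ¬-not (i∉s ∘ lookup⇒[]= i s)

  lookup≡false⇒∉ : V.lookup s i ≡ false → i ∉ s
  lookup≡false⇒∉ sᵢ≡false i∈s = true≢false (trans (sym ([]=⇒lookup i∈s)) sᵢ≡false)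

module _ {n : ℕ} where

  ev : Subset n → Poly n → Bool
  ev d = linExt (monomialAt d)

  ev-≈ : ∀ d {p q : Poly n} → p ≈ q → ev d p ≡ ev d q
  ev-≈ d {p} {q} p≈q = linExt-≡ (≈⇒≋ {p = p} {q} p≈q) (monomialAt d)

  ev-++ : ∀ d (p q : Poly n) → ev d (p ++ q) ≡ ev d p xor ev d q
  ev-++ d = linExt-++ (monomialAt d)

  ev-* : ∀ d (p q : Poly n) → ev d (p * q) ≡ ev d p ∧ ev d q
  ev-* d p q = begin
    ev d (p * q)                                                       ≡⟨ linExt-* (monomialAt d) p q ⟩
    linExt (λ a → linExt (λ b → monomialAt d (a ⊞ b)) q) p             ≡⟨ linExt-cong p (λ a →
                                                                            linExt-cong q (monomialAt-⊞ d a)) ⟩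
    linExt (λ a → linExt (λ b → monomialAt d a ∧ monomialAt d b) q) p  ≡⟨ linExt-cong p (λ a →
                                                                            linExt-∧ˡ (monomialAt d a) _ q) ⟩
    linExt (λ a → monomialAt d a ∧ ev d q) p                           ≡⟨ linExt-∧ʳ (ev d q) _ p ⟩
    ev d p ∧ ev d q                                                    ∎
    where open ≡-Reasoning

  ev-one : ∀ d → ev d one ≡ true
  ev-one d = trans (xor-identityʳ _) (monomialAt-replicate0 d)

  ev-x : ∀ d i → ev d (x i) ≡ V.lookup d i
  ev-x d i = trans (xor-identityʳ _) (monomialAt-xᵢ d i)

  ev-one-x : ∀ d i → ev d (one - x i) ≡ not (V.lookup d i)
  ev-one-x d i = trans (ev-++ d one (x i)) (cong₂ _xor_ (ev-one d) (ev-x d i))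

  prodOverList : Subset n → (Fin n → Poly n) → List (Fin n) → Poly n
  prodOverList s f = foldr (λ i acc → if V.lookup s i then f i * acc else acc) one

  prodOverList-cong : ∀ s s′ f (L : List (Fin n)) → (∀ {i} → i ∈ₗ L → V.lookup s i ≡ V.lookup s′ i) →
                      prodOverList s f L ≡ prodOverList s′ f L
  prodOverList-cong s s′ f []      _     = refl
  prodOverList-cong s s′ f (i ∷ L) agree = cong₂ (λ b acc → if b then f i * acc else acc)
    (agree (here refl)) (prodOverList-cong s s′ f L (agree ∘ there))

  prodOverList-insert : ∀ s f {l} (L : List (Fin n)) → Unique L → l ∈ₗ L → V.lookup s l ≡ false →
                        prodOverList (s V.[ l ]≔ true) f L ≋ f l * prodOverList s f L
  prodOverList-insert s f (i ∷ L) (i∉L ∷ _) (here refl) sᵢ≡false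
    rewrite lookup∘update i s true | sᵢ≡false = *-congˡ (f i) (≋-reflexive
      (prodOverList-cong (s V.[ i ]≔ true) s f L (λ j∈L → lookup∘update′ (All.lookup i∉L j∈L ∘ sym) s true)))
  prodOverList-insert s f {l} (i ∷ L) (i∉L ∷ unique) (there l∈L) sₗ≡false
    rewrite lookup∘update′ (All.lookup i∉L l∈L) s true with V.lookup s i
  ... | true  = ≋-trans (*-congˡ (f i) (prodOverList-insert s f L unique l∈L sₗ≡false))
                        (*-leftComm (f i) (f l) _)
  ... | false = prodOverList-insert s f L unique l∈L sₗ≡false

  prodOver-insert : ∀ {s l} f → l ∉ s → prodOver (s V.[ l ]≔ true) f ≋ f l * prodOver s f
  prodOver-insert {s} {l} f l∉s =
    prodOverList-insert s f (allFin n) (allFin⁺ n) (∈-allFin l) (∉⇒lookup≡false l∉s)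

  ev-prodOverList⁺ : ∀ d s f (L : List (Fin n)) → (∀ {i} → i ∈ s → ev d (f i) ≡ true) →
                     ev d (prodOverList s f L) ≡ true
  ev-prodOverList⁺ d s f []      _     = ev-one d
  ev-prodOverList⁺ d s f (i ∷ L) all-f with V.lookup s i in sᵢ
  ... | true  = trans (ev-* d (f i) _)
                      (cong₂ _∧_ (all-f (lookup⇒[]= i s sᵢ)) (ev-prodOverList⁺ d s f L all-f))
  ... | false = ev-prodOverList⁺ d s f L all-f

  ev-prodOverList⁻ : ∀ d s f (L : List (Fin n)) → ev d (prodOverList s f L) ≡ true →
                     ∀ {i} → i ∈ₗ L → i ∈ s → ev d (f i) ≡ true
  ev-prodOverList⁻ d s f (j ∷ L) prod≡true i∈L i∈s with V.lookup s j in sⱼ | i∈L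
  ... | true  | here refl  = ∧-conicalˡ _ _ (trans (sym (ev-* d (f j) _)) prod≡true)
  ... | true  | there i∈L′ =
    ev-prodOverList⁻ d s f L (∧-conicalʳ _ _ (trans (sym (ev-* d (f j) _)) prod≡true)) i∈L′ i∈s
  ... | false | here refl  = ⊥-elim (lookup≡false⇒∉ sⱼ i∈s)
  ... | false | there i∈L′ = ev-prodOverList⁻ d s f L prod≡true i∈L′ i∈s

  ev-pm⁺ : ∀ {d σ τ : Subset n} → σ ⊆ d → Disjoint τ d → ev d (pm σ τ) ≡ true
  ev-pm⁺ {d} {σ} {τ} σ⊆d τ∩d≡∅ = trans (ev-* d (prodOver σ x) _) (cong₂ _∧_
    (ev-prodOverList⁺ d σ x (allFin n) (λ {i} i∈σ → trans (ev-x d i) ([]=⇒lookup (σ⊆d i∈σ))))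
    (ev-prodOverList⁺ d τ (λ j → one - x j) (allFin n) (λ {i} i∈τ →
      trans (ev-one-x d i) (cong not (∉⇒lookup≡false (τ∩d≡∅ i i∈τ))))))

  ev-pm⁻ : ∀ {d} (σ τ : Subset n) → ev d (pm σ τ) ≡ true → σ ⊆ d × Disjoint τ d
  ev-pm⁻ {d} σ τ pm≡true =
      (λ {i} i∈σ → lookup⇒[]= i d (trans (sym (ev-x d i)) (x-factor (∈-allFin i) i∈σ)))
    , (λ i i∈τ → lookup≡false⇒∉ (trans (sym (not-involutive _)) (cong not
                   (trans (sym (ev-one-x d i)) (one-x-factor (∈-allFin i) i∈τ)))))
    where
    x-factor : ∀ {i} → i ∈ₗ allFin n → i ∈ σ → ev d (x i) ≡ true
    x-factor = ev-prodOverList⁻ d σ x (allFin n)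
      (∧-conicalˡ _ _ (trans (sym (ev-* d (prodOver σ x) _)) pm≡true))
    one-x-factor : ∀ {i} → i ∈ₗ allFin n → i ∈ τ → ev d (one - x i) ≡ true
    one-x-factor = ev-prodOverList⁻ d τ (λ j → one - x j) (allFin n)
      (∧-conicalʳ _ _ (trans (sym (ev-* d (prodOver σ x) _)) pm≡true))

  ev-ρ≡true⇒≡ : ∀ {d v : Subset n} → ev d (ρ v) ≡ true → d ≡ v
  ev-ρ≡true⇒≡ {d} {v} ρ≡true = ⊆-antisym d⊆v (proj₁ (ev-pm⁻ v (∁ v) ρ≡true))
    where
    d⊆v : d ⊆ v
    d⊆v {i} i∈d = decidable-stable (i ∈? v) λ i∉v →
      proj₂ (ev-pm⁻ v (∁ v) ρ≡true) i (x∉p⇒x∈∁p i∉v) i∈d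

  pseudoMonomial-nonvanishing : ∀ {f : Poly n} → IsPseudoMonomial f → ∃ λ d → ev d f ≡ true
  pseudoMonomial-nonvanishing {f} (σ , τ , σ∩τ≡∅ , f≈) =
    σ , trans (ev-≈ σ {f} {pm σ τ} f≈) (ev-pm⁺ ⊆-refl (λ i i∈τ i∈σ → σ∩τ≡∅ i i∈σ i∈τ))

  overlapping-pm-not-pseudoMonomial : ∀ {σ τ : Subset n} {i} → i ∈ σ → i ∈ τ → ¬ IsPseudoMonomial (pm σ τ)
  overlapping-pm-not-pseudoMonomial {σ} {τ} {i} i∈σ i∈τ isPM
    with pseudoMonomial-nonvanishing {f = pm σ τ} isPM
  ... | d , pm≡true with ev-pm⁻ {d = d} σ τ pm≡true
  ...   | σ⊆d , τ∩d≡∅ = τ∩d≡∅ i i∈τ (σ⊆d i∈σ)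

  ∣⇒ev≡true : ∀ {f g : Poly n} {d} → g ∣ f → ev d f ≡ true → ev d g ≡ true
  ∣⇒ev≡true {f} {g} {d} (h , f≈hg) f≡true =
    ∧-conicalʳ _ _ (trans (sym (ev-* d h g)) (trans (sym (ev-≈ d {f} {h * g} f≈hg)) f≡true))

-- The neural ideal

module _ {n : ℕ} {s : Subset n} {l : Fin n} where

  ∈-insert⁺ : ∀ {i} → i ∈ s → i ∈ s V.[ l ]≔ true
  ∈-insert⁺ {i} i∈s with i F.≟ l
  ... | yes refl = []≔-updates s l
  ... | no  i≢l  = []≔-minimal s i l i≢l i∈s

  ∈-insert⁻ : ∀ {i} → i ∈ s V.[ l ]≔ true → i ≡ l ⊎ i ∈ s
  ∈-insert⁻ {i} i∈s′ with i F.≟ l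
  ... | yes i≡l = inj₁ i≡l
  ... | no  i≢l = inj₂ (lookup⇒[]= i s (trans (sym (lookup∘update′ i≢l s true)) ([]=⇒lookup i∈s′)))

disjoint-cover⇒≡∁ : ∀ {n} {σ τ : Subset n} → Disjoint σ τ → (∀ {i} → i ∉ σ → i ∉ τ → ⊥) → τ ≡ ∁ σ
disjoint-cover⇒≡∁ {σ = σ} {τ} σ∩τ≡∅ cover = ⊆-antisym
  (λ {i} i∈τ → x∉p⇒x∈∁p (λ i∈σ → σ∩τ≡∅ i i∈σ i∈τ))
  (λ {i} i∈∁σ → decidable-stable (i ∈? τ) (cover (x∈∁p⇒x∉p i∈∁σ)))

pm-split : ∀ {n} {σ τ : Subset n} {l} → l ∉ σ → l ∉ τ →
           pm σ τ ≋ pm (σ V.[ l ]≔ true) τ ++ pm σ (τ V.[ l ]≔ true)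
pm-split {σ = σ} {τ} {l} l∉σ l∉τ = begin
  Q                                                 ≈⟨ ++-cancel (x l * Q) Q ⟨
  x l * Q ++ (Q ++ x l * Q)                         ≈⟨ ++-congˡ (x l * Q) (++-congʳ (x l * Q) (*-identityˡ Q)) ⟨
  x l * Q ++ (one * Q ++ x l * Q)                   ≈⟨ ++-congˡ (x l * Q) (*-distribʳ-++ one (x l) Q) ⟨
  x l * Q ++ (one - x l) * Q                        ≈⟨ ++-cong x-factor one-x-factor ⟨
  pm (σ V.[ l ]≔ true) τ ++ pm σ (τ V.[ l ]≔ true)  ∎
  where
  open SetoidReasoning ≋-setoid
  Xσ = prodOver σ x
  Tτ = prodOver τ (λ j → one - x j)
  Q  = pm σ τ
  x-factor : pm (σ V.[ l ]≔ true) τ ≋ x l * Q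
  x-factor = ≋-trans (*-congʳ Tτ (prodOver-insert x l∉σ)) (*-assoc (x l) Xσ Tτ)
  one-x-factor : pm σ (τ V.[ l ]≔ true) ≋ (one - x l) * Q
  one-x-factor =
    ≋-trans (*-congˡ Xσ (prodOver-insert (λ j → one - x j) l∉τ)) (*-leftComm Xσ (one - x l) Tτ)

module _ {n : ℕ} (C : Code n) where

  term : Subset n × Poly n → Poly n
  term (v , h) = h * ρ v

  combination : List (Subset n × Poly n) → Poly n
  combination gs = sumP (map term gs)

  InNeuralIdeal-resp-≋ : ∀ {f g} → f ≋ g → InNeuralIdeal C g → InNeuralIdeal C f
  InNeuralIdeal-resp-≋ {g = g} f≋g (gs , gs∉C , g≈) =
    gs , gs∉C , ≋⇒≈ (≋-trans f≋g (≈⇒≋ {p = g} {combination gs} g≈))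

  InNeuralIdeal-++ : ∀ f g → InNeuralIdeal C f → InNeuralIdeal C g → InNeuralIdeal C (f ++ g)
  InNeuralIdeal-++ f g (gs , gs∉C , f≈) (hs , hs∉C , g≈) = gs L.++ hs , All.++⁺ gs∉C hs∉C , ≋⇒≈ (begin
    f ++ g
      ≈⟨ ++-cong (≈⇒≋ {p = f} {combination gs} f≈) (≈⇒≋ {p = g} {combination hs} g≈) ⟩
    combination gs ++ combination hs
      ≡⟨ concat-++ (map term gs) (map term hs) ⟩
    sumP (map term gs L.++ map term hs)
      ≡⟨ cong sumP (map-++ term gs hs) ⟨
    combination (gs L.++ hs)
      ∎)
    where open SetoidReasoning ≋-setoid

  ρ∈J : ∀ {v} → v ∉ₗ C → InNeuralIdeal C (ρ v)
  ρ∈J {v} v∉C = (v , one) ∷ [] , v∉C ∷ [] ,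
    ≋⇒≈ (≋-sym (≋-trans (≋-reflexive (++-identityʳ (one * ρ v))) (*-identityˡ (ρ v))))

  InNeuralIdeal⇒ev≡false : ∀ {f c} → InNeuralIdeal C f → c ∈ₗ C → ev c f ≡ false
  InNeuralIdeal⇒ev≡false {f} {c} (gs , gs∉C , f≈) c∈C =
    trans (ev-≈ c {f} {combination gs} f≈) (vanishes gs gs∉C)
    where
    vanishes : ∀ gs → All (λ { (v , h) → v ∉ₗ C }) gs → ev c (combination gs) ≡ false
    vanishes []             []           = refl
    vanishes ((v , h) ∷ gs) (v∉C ∷ gs∉C) = begin
      ev c (h * ρ v ++ combination gs)           ≡⟨ ev-++ c (h * ρ v) _ ⟩
      ev c (h * ρ v) xor ev c (combination gs)   ≡⟨ cong₂ _xor_ (ev-* c h (ρ v)) (vanishes gs gs∉C) ⟩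
      (ev c h ∧ ev c (ρ v)) xor false            ≡⟨ cong (λ b → (ev c h ∧ b) xor false) ρᵥ≡false ⟩
      (ev c h ∧ false) xor false                 ≡⟨ cong (_xor false) (∧-zeroʳ (ev c h)) ⟩
      false                                      ∎
      where
      open ≡-Reasoning
      ρᵥ≡false : ev c (ρ v) ≡ false
      ρᵥ≡false = ¬-not (λ ρ≡true → v∉C (subst (_∈ₗ C) (ev-ρ≡true⇒≡ ρ≡true) c∈C))

  pm∈J⇒avoids : ∀ {σ τ} → InNeuralIdeal C (pm σ τ) → ∀ c → σ ⊆ c → Disjoint τ c → c ∉ₗ C
  pm∈J⇒avoids {σ} {τ} pmστ∈J c σ⊆c τ∩c≡∅ c∈C =
    true≢false (trans (sym (ev-pm⁺ σ⊆c τ∩c≡∅)) (InNeuralIdeal⇒ev≡false {f = pm σ τ} pmστ∈J c∈C))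

  -- Split along x_l + (1 - x_l) at every coordinate l that is neither in σ nor in τ;
  -- when none is left, τ = ∁ σ and pm σ τ is ρ σ.
  pm∈J : ∀ {σ τ} → Disjoint σ τ → (∀ v → σ ⊆ v → Disjoint τ v → v ∉ₗ C) → InNeuralIdeal C (pm σ τ)
  pm∈J = resolve (allFin n) (λ {i} _ _ → ∈-allFin i)
    where
    resolve : ∀ {σ τ} (L : List (Fin n)) → (∀ {i} → i ∉ σ → i ∉ τ → i ∈ₗ L) →
              Disjoint σ τ → (∀ v → σ ⊆ v → Disjoint τ v → v ∉ₗ C) → InNeuralIdeal C (pm σ τ)
    resolve {σ} {τ} [] free σ∩τ≡∅ avoids =
      subst (λ t → InNeuralIdeal C (pm σ t)) (sym (disjoint-cover⇒≡∁ σ∩τ≡∅ (λ i∉σ → ¬Any[] ∘ free i∉σ)))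
            (ρ∈J (avoids σ ⊆-refl (λ i i∈τ i∈σ → σ∩τ≡∅ i i∈σ i∈τ)))
    resolve {σ} {τ} (l ∷ L) free σ∩τ≡∅ avoids with l ∈? σ | l ∈? τ
    ... | yes l∈σ | _       = resolve L (λ i∉σ i∉τ → ∈-∷⁻ (free i∉σ i∉τ) (λ { refl → i∉σ l∈σ })) σ∩τ≡∅ avoids
    ... | no  _   | yes l∈τ = resolve L (λ i∉σ i∉τ → ∈-∷⁻ (free i∉σ i∉τ) (λ { refl → i∉τ l∈τ })) σ∩τ≡∅ avoids
    ... | no  l∉σ | no  l∉τ =
      InNeuralIdeal-resp-≋ (pm-split l∉σ l∉τ) (InNeuralIdeal-++ (pm σ′ τ) (pm σ τ′) x-branch one-x-branch)
      where
      σ′ = σ V.[ l ]≔ true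
      τ′ = τ V.[ l ]≔ true
      x-branch : InNeuralIdeal C (pm σ′ τ)
      x-branch = resolve L
        (λ i∉σ′ i∉τ → ∈-∷⁻ (free (i∉σ′ ∘ ∈-insert⁺) i∉τ) (λ { refl → i∉σ′ ([]≔-updates σ l) }))
        (λ i i∈σ′ i∈τ → [ (λ { refl → l∉τ i∈τ }) , (λ i∈σ → σ∩τ≡∅ i i∈σ i∈τ) ] (∈-insert⁻ i∈σ′))
        (λ v σ′⊆v → avoids v (σ′⊆v ∘ ∈-insert⁺))
      one-x-branch : InNeuralIdeal C (pm σ τ′)
      one-x-branch = resolve L
        (λ i∉σ i∉τ′ → ∈-∷⁻ (free i∉σ (i∉τ′ ∘ ∈-insert⁺)) (λ { refl → i∉τ′ ([]≔-updates τ l) }))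
        (λ i i∈σ i∈τ′ → [ (λ { refl → l∉σ i∈σ }) , (σ∩τ≡∅ i i∈σ) ] (∈-insert⁻ i∈τ′))
        (λ v σ⊆v τ′∩v≡∅ → avoids v σ⊆v (λ i i∈τ → τ′∩v≡∅ i (∈-insert⁺ i∈τ)))

-- The general relationship complex

module _ {n : ℕ} {i j : Fin n} where

  x∈⁅x⁆∪⁅y⁆ : i ∈ ⁅ i ⁆ ∪ ⁅ j ⁆
  x∈⁅x⁆∪⁅y⁆ = x∈p∪q⁺ (inj₁ (x∈⁅x⁆ i))

  y∈⁅x⁆∪⁅y⁆ : j ∈ ⁅ i ⁆ ∪ ⁅ j ⁆
  y∈⁅x⁆∪⁅y⁆ = x∈p∪q⁺ (inj₂ (x∈⁅x⁆ j))

  x∈⁅y⁆∪⁅z⁆⇒x≡y⊎x≡z : ∀ {k} → k ∈ ⁅ i ⁆ ∪ ⁅ j ⁆ → k ≡ i ⊎ k ≡ j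
  x∈⁅y⁆∪⁅z⁆⇒x≡y⊎x≡z k∈ij = Sum.map (x∈⁅y⁆⇒x≡y i) (x∈⁅y⁆⇒x≡y j) (x∈p∪q⁻ ⁅ i ⁆ ⁅ j ⁆ k∈ij)

  ⁅x⁆∪⁅y⁆⊆p : ∀ {s} → i ∈ s → j ∈ s → ⁅ i ⁆ ∪ ⁅ j ⁆ ⊆ s
  ⁅x⁆∪⁅y⁆⊆p i∈s j∈s k∈ij with x∈⁅y⁆∪⁅z⁆⇒x≡y⊎x≡z k∈ij
  ... | inj₁ refl = i∈s
  ... | inj₂ refl = j∈s

  p⊆⁅x⁆∪⁅y⁆∧y∉p⇒p⊆⁅x⁆ : ∀ {A} → A ⊆ ⁅ i ⁆ ∪ ⁅ j ⁆ → j ∉ A → A ⊆ ⁅ i ⁆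
  p⊆⁅x⁆∪⁅y⁆∧y∉p⇒p⊆⁅x⁆ A⊆ij j∉A k∈A with x∈⁅y⁆∪⁅z⁆⇒x≡y⊎x≡z (A⊆ij k∈A)
  ... | inj₁ refl = x∈⁅x⁆ i
  ... | inj₂ refl = ⊥-elim (j∉A k∈A)

⁅x⁆⊆p : ∀ {n} {i : Fin n} {s} → i ∈ s → ⁅ i ⁆ ⊆ s
⁅x⁆⊆p {i = i} i∈s k∈⁅i⁆ = subst (_∈ _) (sym (x∈⁅y⁆⇒x≡y i k∈⁅i⁆)) i∈s

subset-of-pair : ∀ {n} {i j : Fin n} {A} → A ⊆ ⁅ i ⁆ ∪ ⁅ j ⁆ → Nonempty A →
                 A ≡ ⁅ i ⁆ ⊎ A ≡ ⁅ j ⁆ ⊎ A ≡ ⁅ i ⁆ ∪ ⁅ j ⁆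
subset-of-pair {i = i} {j} {A} A⊆ij (k , k∈A) with i ∈? A | j ∈? A
... | yes i∈A | yes j∈A = inj₂ (inj₂ (⊆-antisym A⊆ij (⁅x⁆∪⁅y⁆⊆p i∈A j∈A)))
... | yes i∈A | no  j∉A = inj₁ (⊆-antisym (p⊆⁅x⁆∪⁅y⁆∧y∉p⇒p⊆⁅x⁆ A⊆ij j∉A) (⁅x⁆⊆p i∈A))
... | no  i∉A | yes j∈A =
  inj₂ (inj₁ (⊆-antisym (p⊆⁅x⁆∪⁅y⁆∧y∉p⇒p⊆⁅x⁆ (subst (A ⊆_) (∪-comm ⁅ i ⁆ ⁅ j ⁆) A⊆ij) i∉A) (⁅x⁆⊆p j∈A)))
... | no  i∉A | no  j∉A =
  ⊥-elim ([ (λ { refl → i∉A k∈A }) , (λ { refl → j∉A k∈A }) ]′ (x∈⁅y⁆∪⁅z⁆⇒x≡y⊎x≡z (A⊆ij k∈A)))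

module _ {n : ℕ} (C : Code n) where

  InGR-antitone : ∀ {σ σ′} → σ′ ⊆ σ → InGR C σ → InGR C σ′
  InGR-antitone σ′⊆σ inGR A B A⊆σ′ B⊆σ′ = inGR A B (σ′⊆σ ∘ A⊆σ′) (σ′⊆σ ∘ B⊆σ′)

  AllPatternsOn : Subset n → Set
  AllPatternsOn σ = ∀ A B → A ⊆ σ → B ⊆ σ → Disjoint A B → ∃ λ c → c ∈ₗ C × A ⊆ c × Disjoint B c

  allPatterns⇒InGR : ∀ {σ} → AllPatternsOn σ → InGR C σ
  allPatterns⇒InGR patterns A B A⊆σ B⊆σ (isPM , f∈J , _) with nonempty? (A ∩ B)
  ... | yes (i , i∈A∩B) = overlapping-pm-not-pseudoMonomial (proj₁ i∈A×i∈B) (proj₂ i∈A×i∈B) isPM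
    where i∈A×i∈B = x∈p∩q⁻ A B i∈A∩B
  ... | no  A∩B≡∅ with patterns A B A⊆σ B⊆σ (λ i i∈A i∈B → A∩B≡∅ (i , x∈p∩q⁺ (i∈A , i∈B)))
  ...   | c , c∈C , A⊆c , B∩c≡∅ = pm∈J⇒avoids C f∈J c A⊆c B∩c≡∅ c∈C

  allPatterns-from-subsets : ∀ {σ} → (∀ A → A ⊆ σ → Nonempty A → A ∈ₗ C) →
                             (∃ λ c → c ∈ₗ C × Disjoint σ c) → AllPatternsOn σ
  allPatterns-from-subsets subsets (c , c∈C , σ∩c≡∅) A B A⊆σ B⊆σ A∩B≡∅ with nonempty? A
  ... | yes A≢∅ = A , subsets A A⊆σ A≢∅ , ⊆-refl , λ k k∈B k∈A → A∩B≡∅ k k∈A k∈B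
  ... | no  A≡∅ = c , c∈C , (λ k∈A → ⊥-elim (A≡∅ (_ , k∈A))) , λ k k∈B → σ∩c≡∅ k (B⊆σ k∈B)

  pair∈GR : ∀ {i j m} → ⁅ i ⁆ ∈ₗ C → ⁅ j ⁆ ∈ₗ C → ⁅ i ⁆ ∪ ⁅ j ⁆ ∈ₗ C → ⁅ m ⁆ ∈ₗ C → m ≢ i → m ≢ j →
            InGR C (⁅ i ⁆ ∪ ⁅ j ⁆)
  pair∈GR {i} {j} {m} i∈C j∈C ij∈C m∈C m≢i m≢j =
    allPatterns⇒InGR (allPatterns-from-subsets subsets (⁅ m ⁆ , m∈C , m-outside))
    where
    subsets : ∀ A → A ⊆ ⁅ i ⁆ ∪ ⁅ j ⁆ → Nonempty A → A ∈ₗ C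
    subsets A A⊆ij A≢∅ with subset-of-pair A⊆ij A≢∅
    ... | inj₁ refl        = i∈C
    ... | inj₂ (inj₁ refl) = j∈C
    ... | inj₂ (inj₂ refl) = ij∈C
    m-outside : Disjoint (⁅ i ⁆ ∪ ⁅ j ⁆) ⁅ m ⁆
    m-outside k k∈ij k∈⁅m⁆ with x∈⁅y⁆∪⁅z⁆⇒x≡y⊎x≡z k∈ij | x∈⁅y⁆⇒x≡y m k∈⁅m⁆
    ... | inj₁ refl | refl = m≢i refl
    ... | inj₂ refl | refl = m≢j refl

  -- Dropping x_i (or x_j) from x_i x_j leaves a pseudo-monomial that is nonzero at
  -- the codeword ⁅ j ⁆ (or ⁅ i ⁆), hence not in J_C.
  pm∈J-supported-on-pair : ∀ {i j σ τ} → ⁅ i ⁆ ∈ₗ C → ⁅ j ⁆ ∈ₗ C → InNeuralIdeal C (pm σ τ) →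
                           (∀ {d} → ⁅ i ⁆ ∪ ⁅ j ⁆ ⊆ d → σ ⊆ d × Disjoint τ d) →
                           σ ≡ ⁅ i ⁆ ∪ ⁅ j ⁆ × τ ≡ ∅
  pm∈J-supported-on-pair {i} {j} {σ} {τ} i∈C j∈C pmστ∈J nonzero-on-ij =
    ⊆-antisym σ⊆ij (⁅x⁆∪⁅y⁆⊆p i∈σ j∈σ) , Empty-unique (τ-empty ∘ proj₂)
    where
    τ-empty : ∀ {k} → k ∉ τ
    τ-empty {k} k∈τ = proj₂ (nonzero-on-ij ⊆⊤) k k∈τ ∈⊤
    σ⊆ij : σ ⊆ ⁅ i ⁆ ∪ ⁅ j ⁆
    σ⊆ij = proj₁ (nonzero-on-ij ⊆-refl)
    not-within : ∀ {l} → σ ⊆ ⁅ l ⁆ → ⁅ l ⁆ ∉ₗ C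
    not-within σ⊆l = pm∈J⇒avoids C pmστ∈J _ σ⊆l (λ k k∈τ _ → τ-empty k∈τ)
    i∈σ : i ∈ σ
    i∈σ = decidable-stable (i ∈? σ) λ i∉σ →
      not-within (p⊆⁅x⁆∪⁅y⁆∧y∉p⇒p⊆⁅x⁆ (subst (σ ⊆_) (∪-comm ⁅ i ⁆ ⁅ j ⁆) σ⊆ij) i∉σ) j∈C
    j∈σ : j ∈ σ
    j∈σ = decidable-stable (j ∈? σ) λ j∉σ → not-within (p⊆⁅x⁆∪⁅y⁆∧y∉p⇒p⊆⁅x⁆ σ⊆ij j∉σ) i∈C

  pair∈CF : ∀ {i j} → ⁅ i ⁆ ∈ₗ C → ⁅ j ⁆ ∈ₗ C → (∀ v → i ∈ v → j ∈ v → v ∉ₗ C) →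
            InCF C (pm (⁅ i ⁆ ∪ ⁅ j ⁆) ∅)
  pair∈CF {i} {j} i∈C j∈C separated = isPM , pm∈J C (λ _ _ → ∉⊥) avoids , minimal
    where
    ij = ⁅ i ⁆ ∪ ⁅ j ⁆
    isPM : IsPseudoMonomial (pm ij ∅)
    isPM = ij , ∅ , (λ _ _ → ∉⊥) , λ m → refl
    avoids : ∀ v → ij ⊆ v → Disjoint ∅ v → v ∉ₗ C
    avoids v ij⊆v _ = separated v (ij⊆v x∈⁅x⁆∪⁅y⁆) (ij⊆v y∈⁅x⁆∪⁅y⁆)
    minimal : ∀ g → IsPseudoMonomial g → InNeuralIdeal C g → deg g < deg (pm ij ∅) → g ∣ pm ij ∅ → ⊥
    minimal g (σ , τ , _ , g≈) g∈J deg-g<deg-f g∣f = ℕ.<⇒≱ deg-g<deg-f (deg-mono (pm ij ∅) g f≈g)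
      where
      nonzero-on-ij : ∀ {d} → ij ⊆ d → σ ⊆ d × Disjoint τ d
      nonzero-on-ij {d} ij⊆d = ev-pm⁻ σ τ (trans (sym (ev-≈ d {g} {pm σ τ} g≈))
        (∣⇒ev≡true {f = pm ij ∅} {d = d} g∣f (ev-pm⁺ ij⊆d (λ _ k∈∅ _ → ∉⊥ k∈∅))))
      f≈g : pm ij ∅ ≈ g
      f≈g m with pm∈J-supported-on-pair i∈C j∈C
                   (InNeuralIdeal-resp-≋ C (≋-sym (≈⇒≋ {p = g} {pm σ τ} g≈)) g∈J) nonzero-on-ij
      ... | refl , refl = sym (g≈ m)

  pair∉GR : ∀ {i j} → ⁅ i ⁆ ∈ₗ C → ⁅ j ⁆ ∈ₗ C → (∀ v → i ∈ v → j ∈ v → v ∉ₗ C) →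
            ¬ InGR C (⁅ i ⁆ ∪ ⁅ j ⁆)
  pair∉GR i∈C j∈C separated inGR = inGR _ ∅ ⊆-refl (⊆-min _) (pair∈CF i∈C j∈C separated)

-- The code C_R(k)

module _ {k : ℕ} (P : ℕ → Bool) {i : Fin k} where

  ∈-setOf⁺ : T (P (toℕ i)) → i ∈ setOf P
  ∈-setOf⁺ Pᵢ = lookup⇒[]= i (setOf P) (trans (lookup∘tabulate _ i) (Equivalence.to T-≡ Pᵢ))

  ∈-setOf⁻ : i ∈ setOf P → T (P (toℕ i))
  ∈-setOf⁻ i∈P = Equivalence.from T-≡ (trans (sym (lookup∘tabulate _ i)) ([]=⇒lookup i∈P))

module _ {k : ℕ} where

  ∈-setOf-≡ᵇ⁻ : ∀ {a} {l : Fin k} → l ∈ setOf (λ t → t ≡ᵇ a) → toℕ l ≡ a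
  ∈-setOf-≡ᵇ⁻ {a} l∈ = ℕ.≡ᵇ⇒≡ _ _ (∈-setOf⁻ (λ t → t ≡ᵇ a) l∈)

  ∈-setOf-∨⁻ : ∀ {a b} {l : Fin k} → l ∈ setOf (λ t → (t ≡ᵇ a) ∨ (t ≡ᵇ b)) → toℕ l ≡ a ⊎ toℕ l ≡ b
  ∈-setOf-∨⁻ {a} {b} l∈ =
    Sum.map (ℕ.≡ᵇ⇒≡ _ _) (ℕ.≡ᵇ⇒≡ _ _) (Equivalence.to T-∨ (∈-setOf⁻ (λ t → (t ≡ᵇ a) ∨ (t ≡ᵇ b)) l∈))

  setOf-≡ᵇ : ∀ (i : Fin k) → setOf (λ t → t ≡ᵇ toℕ i) ≡ ⁅ i ⁆
  setOf-≡ᵇ i = ⊆-antisym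
    (λ l∈ → subst (_∈ ⁅ i ⁆) (sym (toℕ-injective (∈-setOf-≡ᵇ⁻ l∈))) (x∈⁅x⁆ i))
    (λ l∈⁅i⁆ → ∈-setOf⁺ (λ t → t ≡ᵇ toℕ i) (ℕ.≡⇒≡ᵇ _ _ (cong toℕ (x∈⁅y⁆⇒x≡y i l∈⁅i⁆))))

  setOf-∨-≡ᵇ : ∀ (i j : Fin k) → setOf (λ t → (t ≡ᵇ toℕ i) ∨ (t ≡ᵇ toℕ j)) ≡ ⁅ i ⁆ ∪ ⁅ j ⁆
  setOf-∨-≡ᵇ i j = ⊆-antisym
    (λ l∈ → [ (λ l≡i → subst (_∈ ⁅ i ⁆ ∪ ⁅ j ⁆) (sym (toℕ-injective l≡i)) x∈⁅x⁆∪⁅y⁆)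
            , (λ l≡j → subst (_∈ ⁅ i ⁆ ∪ ⁅ j ⁆) (sym (toℕ-injective l≡j)) y∈⁅x⁆∪⁅y⁆) ]′ (∈-setOf-∨⁻ l∈))
    (λ l∈ij → ∈-setOf⁺ (λ t → (t ≡ᵇ toℕ i) ∨ (t ≡ᵇ toℕ j)) (Equivalence.from T-∨
      (Sum.map (ℕ.≡⇒≡ᵇ _ _ ∘ cong toℕ) (ℕ.≡⇒≡ᵇ _ _ ∘ cong toℕ) (x∈⁅y⁆∪⁅z⁆⇒x≡y⊎x≡z l∈ij))))

-- k is written 3 + n, so that the neuron k ∸ 1 occurring in CR k computes to last.
module CycleCode (n : ℕ) where

  k : ℕ
  k = 3 ℕ.+ n

  last : ℕ
  last = 2 ℕ.+ n

  infix 4 _↦_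
  _↦_ : ℕ → ℕ → Set
  a ↦ b = b ≡ suc a ⊎ (a ≡ last × b ≡ 0)

  Adjacent : ℕ → ℕ → Set
  Adjacent a b = a ↦ b ⊎ b ↦ a

  adjacent? : ∀ a b → Dec (Adjacent a b)
  adjacent? a b = ↦? a b ⊎-dec ↦? b a
    where
    ↦? : ∀ a b → Dec (a ↦ b)
    ↦? a b = b ℕ.≟ suc a ⊎-dec (a ℕ.≟ last ×-dec b ℕ.≟ 0)

  ↦⇒≢ : ∀ {a b} → a ↦ b → a ≢ b
  ↦⇒≢ (inj₁ b≡1+a)          a≡b = ℕ.1+n≢n (sym (trans a≡b b≡1+a))
  ↦⇒≢ (inj₂ (a≡last , b≡0)) a≡b = ℕ.1+n≢0 (trans (sym a≡last) (trans a≡b b≡0))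

  adjacent⇒≢ : ∀ {a b} → Adjacent a b → a ≢ b
  adjacent⇒≢ (inj₁ a↦b) = ↦⇒≢ a↦b
  adjacent⇒≢ (inj₂ b↦a) = ↦⇒≢ b↦a ∘ sym

  next : ℕ → ℕ
  next a with a ℕ.≟ last
  ... | yes _ = 0
  ... | no  _ = suc a

  prev : ℕ → ℕ
  prev zero    = last
  prev (suc a) = a

  ↦-next : ∀ a → a ↦ next a
  ↦-next a with a ℕ.≟ last
  ... | yes a≡last = inj₂ (a≡last , refl)
  ... | no  _      = inj₁ refl

  prev-↦ : ∀ a → prev a ↦ a
  prev-↦ zero    = inj₂ (refl , refl)
  prev-↦ (suc a) = inj₁ refl

  ↦⇒≡next : ∀ {a b} → b < k → a ↦ b → b ≡ next a
  ↦⇒≡next {a} b<k a↦b with a ℕ.≟ last | a↦b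
  ... | yes refl   | inj₁ refl         = ⊥-elim (ℕ.<-irrefl refl b<k)
  ... | yes _      | inj₂ (_ , b≡0)    = b≡0
  ... | no  _      | inj₁ b≡1+a        = b≡1+a
  ... | no  a≢last | inj₂ (a≡last , _) = ⊥-elim (a≢last a≡last)

  ↦⇒≡prev : ∀ {a b} → b ↦ a → b ≡ prev a
  ↦⇒≡prev (inj₁ refl)            = refl
  ↦⇒≡prev (inj₂ (b≡last , refl)) = b≡last

  next≢prev : ∀ a → next a ≢ prev a
  next≢prev a with a ℕ.≟ last
  next≢prev a       | yes refl = ℕ.0≢1+n
  next≢prev zero    | no  _    = ℕ.0≢1+n ∘ ℕ.suc-injective
  next≢prev (suc a) | no  _    = λ 2+a≡a → ℕ.<-irrefl (sym 2+a≡a) (ℕ.m<n⇒m<1+n (ℕ.n<1+n a))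

  next<k : ∀ {a} → a < k → next a < k
  next<k {a} a<k with a ℕ.≟ last
  ... | yes _      = ℕ.z<s
  ... | no  a≢last = ℕ.≤∧≢⇒< a<k (a≢last ∘ ℕ.suc-injective)

  prev<k : ∀ {a} → a < k → prev a < k
  prev<k {zero}  _     = ℕ.n<1+n last
  prev<k {suc a} 1+a<k = ℕ.<-trans (ℕ.n<1+n a) 1+a<k

  nextᶠ prevᶠ : Fin k → Fin k
  nextᶠ i = fromℕ< (next<k (toℕ<n i))
  prevᶠ i = fromℕ< (prev<k (toℕ<n i))

  adjacent-nextᶠ : ∀ i → Adjacent (toℕ i) (toℕ (nextᶠ i))
  adjacent-nextᶠ i = inj₁ (subst (toℕ i ↦_) (sym (toℕ-fromℕ< _)) (↦-next (toℕ i)))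

  adjacent-prevᶠ : ∀ i → Adjacent (toℕ i) (toℕ (prevᶠ i))
  adjacent-prevᶠ i = inj₂ (subst (_↦ toℕ i) (sym (toℕ-fromℕ< _)) (prev-↦ (toℕ i)))

  nextᶠ≢prevᶠ : ∀ i → nextᶠ i ≢ prevᶠ i
  nextᶠ≢prevᶠ i eq =
    next≢prev (toℕ i) (trans (sym (toℕ-fromℕ< _)) (trans (cong toℕ eq) (toℕ-fromℕ< _)))

  adjacent⇒nextᶠ⊎prevᶠ : ∀ {i j} → Adjacent (toℕ i) (toℕ j) → j ≡ nextᶠ i ⊎ j ≡ prevᶠ i
  adjacent⇒nextᶠ⊎prevᶠ {i} {j} (inj₁ i↦j) =
    inj₁ (toℕ-injective (trans (↦⇒≡next (toℕ<n j) i↦j) (sym (toℕ-fromℕ< _))))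
  adjacent⇒nextᶠ⊎prevᶠ {i} {j} (inj₂ j↦i) =
    inj₂ (toℕ-injective (trans (↦⇒≡prev j↦i) (sym (toℕ-fromℕ< _))))

  third-vertex : ∀ (i j : Fin k) → ∃ λ m → m ≢ i × m ≢ j
  third-vertex (suc _)       (suc _)       = zero , (λ ()) , (λ ())
  third-vertex zero          (suc (suc _)) = suc zero , (λ ()) , (λ ())
  third-vertex (suc (suc _)) zero          = suc zero , (λ ()) , (λ ())
  third-vertex zero          zero          = suc zero , (λ ()) , (λ ())
  third-vertex zero          (suc zero)    = suc (suc zero) , (λ ()) , (λ ())
  third-vertex (suc zero)    zero          = suc (suc zero) , (λ ()) , (λ ())

  single : ℕ → Subset k
  single a = setOf (λ t → t ≡ᵇ a)

  consecutive : ℕ → Subset k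
  consecutive a = setOf (λ t → (t ≡ᵇ a) ∨ (t ≡ᵇ suc a))

  singles consecutivePairs : List (Subset k)
  singles          = map single (upTo k)
  consecutivePairs = map consecutive (upTo last)

  single∈CR : ∀ (i : Fin k) → ⁅ i ⁆ ∈ₗ CR k
  single∈CR i = subst (_∈ₗ CR k) (setOf-≡ᵇ i) (∈-++⁺ˡ (∈-map⁺ single (∈-upTo⁺ (toℕ<n i))))

  ↦⇒pair∈CR : ∀ {i j : Fin k} → toℕ i ↦ toℕ j → ⁅ i ⁆ ∪ ⁅ j ⁆ ∈ₗ CR k
  ↦⇒pair∈CR {i} {j} (inj₁ j≡1+i) =
    subst (_∈ₗ CR k) (trans (cong (λ b → setOf (λ t → (t ≡ᵇ toℕ i) ∨ (t ≡ᵇ b))) (sym j≡1+i)) (setOf-∨-≡ᵇ i j))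
      (∈-++⁺ʳ singles (∈-++⁺ˡ (∈-map⁺ consecutive (∈-upTo⁺ (ℕ.s<s⁻¹ (subst (_< k) j≡1+i (toℕ<n j)))))))
  ↦⇒pair∈CR {i} {j} (inj₂ (i≡last , j≡0)) =
    subst (_∈ₗ CR k) (trans (cong₂ (λ a b → setOf (λ t → (t ≡ᵇ a) ∨ (t ≡ᵇ b))) (sym j≡0) (sym i≡last))
                            (trans (setOf-∨-≡ᵇ j i) (∪-comm ⁅ j ⁆ ⁅ i ⁆)))
      (∈-++⁺ʳ singles (∈-++⁺ʳ consecutivePairs (here refl)))

  adjacent⇒pair∈CR : ∀ {i j : Fin k} → Adjacent (toℕ i) (toℕ j) → ⁅ i ⁆ ∪ ⁅ j ⁆ ∈ₗ CR k
  adjacent⇒pair∈CR         (inj₁ i↦j) = ↦⇒pair∈CR i↦j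
  adjacent⇒pair∈CR {i} {j} (inj₂ j↦i) = subst (_∈ₗ CR k) (∪-comm ⁅ j ⁆ ⁅ i ⁆) (↦⇒pair∈CR j↦i)

  two-points-adjacent : ∀ {x y a b} → x ≡ a ⊎ x ≡ b → y ≡ a ⊎ y ≡ b → a ↦ b → x ≡ y ⊎ Adjacent x y
  two-points-adjacent (inj₁ refl) (inj₁ refl) _   = inj₁ refl
  two-points-adjacent (inj₁ refl) (inj₂ refl) a↦b = inj₂ (inj₁ a↦b)
  two-points-adjacent (inj₂ refl) (inj₁ refl) a↦b = inj₂ (inj₂ a↦b)
  two-points-adjacent (inj₂ refl) (inj₂ refl) _   = inj₁ refl

  CR-codeword⇒adjacent : ∀ {v} {i j : Fin k} → v ∈ₗ CR k → i ∈ v → j ∈ v →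
                         i ≡ j ⊎ Adjacent (toℕ i) (toℕ j)
  CR-codeword⇒adjacent v∈CR i∈v j∈v with ∈-++⁻ singles v∈CR
  ... | inj₁ v∈singles with ∈-map⁻ single {xs = upTo k} v∈singles
  ...   | a , _ , refl = inj₁ (toℕ-injective (trans (∈-setOf-≡ᵇ⁻ {a = a} i∈v) (sym (∈-setOf-≡ᵇ⁻ {a = a} j∈v))))
  CR-codeword⇒adjacent v∈CR i∈v j∈v | inj₂ v∈pairs with ∈-++⁻ consecutivePairs v∈pairs
  ... | inj₁ v∈consecutive with ∈-map⁻ consecutive {xs = upTo last} v∈consecutive
  ...   | a , _ , refl = Sum.map₁ toℕ-injective
    (two-points-adjacent (∈-setOf-∨⁻ {a = a} i∈v) (∈-setOf-∨⁻ {a = a} j∈v) (inj₁ refl))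
  CR-codeword⇒adjacent v∈CR i∈v j∈v | inj₂ v∈pairs | inj₂ (here refl) = Sum.map₁ toℕ-injective
    (two-points-adjacent (Sum.swap (∈-setOf-∨⁻ {a = 0} i∈v)) (Sum.swap (∈-setOf-∨⁻ {a = 0} j∈v))
                         (inj₂ (refl , refl)))

  adjacent⇒IsEdge : ∀ {i j} → Adjacent (toℕ i) (toℕ j) → IsEdge (CR k) i j
  adjacent⇒IsEdge {i} {j} adjacent with third-vertex i j
  ... | m , m≢i , m≢j =
      adjacent⇒≢ adjacent ∘ cong toℕ
    , pair∈GR (CR k) (single∈CR i) (single∈CR j) (adjacent⇒pair∈CR adjacent) (single∈CR m) m≢i m≢j

  IsEdge⇒adjacent : ∀ {i j} → IsEdge (CR k) i j → Adjacent (toℕ i) (toℕ j)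
  IsEdge⇒adjacent {i} {j} (i≢j , inGR) = decidable-stable (adjacent? (toℕ i) (toℕ j)) λ ¬adjacent →
    pair∉GR (CR k) (single∈CR i) (single∈CR j)
      (λ v i∈v j∈v v∈CR → [ i≢j , ¬adjacent ]′ (CR-codeword⇒adjacent v∈CR i∈v j∈v)) inGR

mainTheorem17 : (k : ℕ) → 3 ≤ k → TwoRegularOnAll (CR k)
mainTheorem17 _ (s≤s (s≤s (s≤s (z≤n {n})))) = vertex , λ i →
    nextᶠ i , prevᶠ i , nextᶠ≢prevᶠ i
  , adjacent⇒IsEdge (adjacent-nextᶠ i) , adjacent⇒IsEdge (adjacent-prevᶠ i)
  , λ j → adjacent⇒nextᶠ⊎prevᶠ ∘ IsEdge⇒adjacent
  where
  open CycleCode n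
  vertex : ∀ i → IsVertex (CR k) i
  vertex i = InGR-antitone (CR k) (p⊆p∪q _) (proj₂ (adjacent⇒IsEdge (adjacent-nextᶠ i)))
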